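{- If $G$ is a connected graph and $n\ge 1$, then ${\rm gp}(G\boxtimes K_n) = n\cdot {\rm gp}(G)$. Moreover, if ${\rm gp}(G) = \omega(G_{\rm SR})$, then ${\rm gp}(G\boxtimes K_n) = \omega((G\boxtimes K_n)_{\rm SR})$.
   Context: All graphs are finite and simple; $K_n$ is the complete graph on $n$ vertices. The strong product $G\boxtimes H$ has vertex set $V(G)\times V(H)$, with distinct $(g,h),(g',h')$ adjacent iff ($g=g'$ or $gg'\in E(G)$) and ($h=h'$ or $hh'\in E(H)$). For a connected graph $X$, a set $S\subseteq V(X)$ is a general position set if no three pairwise distinct vertices of $S$ lie on a common geodesic of $X$; ${\rm gp}(X)$ is the maximum cardinality of a general position set. A vertex $u$ is maximally distant from $v$ if every neighbor $w$ of $u$ satisfies $d_X(v,w)\le d_X(u,v)$; $u,v$ are mutually maximally distant (MMD) if each is maximally distant from the other. The strong resolving graph $X_{\rm SR}$ has vertex set $V(X)$, two vertices adjacent iff they are MMD in $X$. $\omega$ is the clique number. -}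

module Defs where

open import Level using (0ℓ)
open import Data.Nat using (ℕ; zero; suc; _+_; _*_; _≤_)
open import Data.Fin using (Fin; remQuot)
open import Data.Fin.Subset using (Subset; _∈_; ∣_∣)
open import Data.Product using (Σ; ∃; ∃-syntax; _×_; _,_; proj₁; proj₂)
open import Data.Sum using (_⊎_)
open import Relation.Nullary using (¬_)
open import Relation.Binary.PropositionalEquality using (_≡_)

record Graph : Set₁ where
  field
    order  : ℕ
    Adj    : Fin order → Fin order → Set
    adj-sym    : ∀ {u v} → Adj u v → Adj v u
    irrefl : ∀ {u} → ¬ Adj u u
open Graph public

K : ℕ → Graph
K n = record
  { order = n
  ; Adj = λ i j → ¬ i ≡ j
  ; adj-sym = λ ne eq → ne (Relation.Binary.PropositionalEquality.sym eq)
  ; irrefl = λ ne → ne Relation.Binary.PropositionalEquality.refl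
  }

-- Strong product; vertex (g , h) is encoded as combine g h : Fin (|G| * |H|),
-- decoded with remQuot.
_⊠_ : Graph → Graph → Graph
G ⊠ H = record
  { order = order G * order H
  ; Adj = A
  ; adj-sym = λ { (ne , p , q) → (λ e → ne (Relation.Binary.PropositionalEquality.sym e)) , symG p , symH q }
  ; irrefl = λ { (ne , _) → ne Relation.Binary.PropositionalEquality.refl }
  }
  where
  CloseG : Fin (order G) → Fin (order G) → Set
  CloseG g g' = g ≡ g' ⊎ Adj G g g'
  CloseH : Fin (order H) → Fin (order H) → Set
  CloseH h h' = h ≡ h' ⊎ Adj H h h'
  A : Fin (order G * order H) → Fin (order G * order H) → Set
  A x y = ¬ x ≡ y
        × CloseG (proj₁ (remQuot {order G} (order H) x)) (proj₁ (remQuot {order G} (order H) y))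
        × CloseH (proj₂ (remQuot {order G} (order H) x)) (proj₂ (remQuot {order G} (order H) y))
  symG : ∀ {g g'} → CloseG g g' → CloseG g' g
  symG (Data.Sum.inj₁ e) = Data.Sum.inj₁ (Relation.Binary.PropositionalEquality.sym e)
  symG (Data.Sum.inj₂ a) = Data.Sum.inj₂ (adj-sym G a)
  symH : ∀ {h h'} → CloseH h h' → CloseH h' h
  symH (Data.Sum.inj₁ e) = Data.Sum.inj₁ (Relation.Binary.PropositionalEquality.sym e)
  symH (Data.Sum.inj₂ a) = Data.Sum.inj₂ (adj-sym H a)

data Walk (G : Graph) : Fin (order G) → Fin (order G) → ℕ → Set where
  here : ∀ {u} → Walk G u u 0
  step : ∀ {u w v k} → Adj G u w → Walk G w v k → Walk G u v (suc k)

Connected : Graph → Set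
Connected G = ∀ u v → ∃[ k ] Walk G u v k

Dist : (G : Graph) → Fin (order G) → Fin (order G) → ℕ → Set
Dist G u v k = Walk G u v k × (∀ l → Walk G u v l → k ≤ l)

Between : (G : Graph) → Fin (order G) → Fin (order G) → Fin (order G) → Set
Between G a b c = ∃[ k ] ∃[ l ] (Dist G a b k × Dist G b c l × Dist G a c (k + l))

-- General position set: no three pairwise distinct vertices on a common
-- geodesic (quantifying over all orderings covers which one is in the middle).
GPSet : (G : Graph) → Subset (order G) → Set
GPSet G S = ∀ a b c → a ∈ S → b ∈ S → c ∈ S →
  ¬ a ≡ b → ¬ b ≡ c → ¬ a ≡ c → ¬ Between G a b c

IsGP : Graph → ℕ → Set
IsGP G k = (∃[ S ] (GPSet G S × ∣ S ∣ ≡ k)) × (∀ S → GPSet G S → ∣ S ∣ ≤ k)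

MaxDistant : (G : Graph) → Fin (order G) → Fin (order G) → Set
MaxDistant G u v = ∀ w → Adj G u w → ∀ k l → Dist G v w k → Dist G u v l → k ≤ l

MMD : (G : Graph) → Fin (order G) → Fin (order G) → Set
MMD G u v = MaxDistant G u v × MaxDistant G v u

SR : Graph → Graph
SR G = record
  { order = order G
  ; Adj = λ u v → ¬ u ≡ v × MMD G u v
  ; adj-sym = λ { (ne , p , q) → (λ e → ne (Relation.Binary.PropositionalEquality.sym e)) , q , p }
  ; irrefl = λ { (ne , _) → ne Relation.Binary.PropositionalEquality.refl }
  }

Clique : (G : Graph) → Subset (order G) → Set
Clique G S = ∀ a b → a ∈ S → b ∈ S → ¬ a ≡ b → Adj G a b

IsCliqueNumber : Graph → ℕ → Set
IsCliqueNumber G k = (∃[ S ] (Clique G S × ∣ S ∣ ≡ k)) × (∀ S → Clique G S → ∣ S ∣ ≤ k)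

module Submission where

-- A vertex x of G ⊠ Kₙ has a G-coordinate π x and a Kₙ-coordinate ι x; the n
-- vertices of a fibre π⁻¹(g) are pairwise adjacent twins.  Two facts drive the proof:
--   * between different fibres, distances in G ⊠ Kₙ equal distances in G
--     (walks lift layer-wise and project without getting longer);
--   * a twin can replace the start of a walk at no extra cost, so no geodesic
--     through three distinct vertices has two of them in a common fibre, and two
--     distinct vertices of a common fibre are mutually maximally distant.
-- Hence the blow-up of a general position set (resp. clique of G_SR) — all n
-- copies of each of its vertices — is one in G ⊠ Kₙ, and the shadow of one in
-- G ⊠ Kₙ — the fibres it meets — is one in G.  Since |blow-up S| = n·|S| and
-- |T| ≤ n·|shadow T|, a purely combinatorial lemma (maximum-blowUp) turns these
-- two transfers into the equality of maxima, for both parameters at once.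

open import Defs
open import Data.Nat using (ℕ; zero; suc; _+_; _*_; _≤_; z≤n; s≤s)
open import Data.Nat.Properties
  using (≤-refl; ≤-trans; ≤-antisym; +-comm; +-mono-≤; *-monoʳ-≤; *-suc; *-zeroʳ;
         m≤n⇒m≤1+n; n≤1+n; m+1+n≰m; module ≤-Reasoning)
open import Data.Bool using (Bool)
open import Data.Fin using (Fin; combine; remQuot; _≟_)
open import Data.Fin.Properties using (remQuot-combine; combine-remQuot)
open import Data.Fin.Subset using (Subset; _∈_; ∣_∣; inside; outside; ⊤; ⊥; Nonempty)
open import Data.Fin.Subset.Properties using (∣⊤∣≡n; ∣⊥∣≡0; ∣p∣≤n; nonempty?; Empty-unique)
open import Data.Vec using (Vec; []; _∷_; _++_; concat; map; replicate; group; lookup)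
open import Data.Vec.Properties
  using (lookup-concat; lookup-map; lookup-replicate; []=⇒lookup; lookup⇒[]=)
open import Data.Product using (∃-syntax; _×_; _,_; proj₁; proj₂)
open import Data.Sum using (_⊎_; inj₁; inj₂)
open import Relation.Nullary using (¬_; does; yes; no; contradiction)
open import Relation.Binary.PropositionalEquality

positive-sum-too-long : ∀ {k l} → 1 ≤ k → ¬ k + l ≤ l
positive-sum-too-long {suc k} {l} _ le = m+1+n≰m l (subst (_≤ l) (+-comm (suc k) l) le)

module _ {H : Graph} where

  walk-zero : ∀ {u v} → Walk H u v 0 → u ≡ v
  walk-zero here = refl

  snoc : ∀ {u v w k} → Walk H u v k → Adj H v w → Walk H u w (suc k)
  snoc here       a = step a here
  snoc (step b r) a = step b (snoc r a)

  reverse : ∀ {u v k} → Walk H u v k → Walk H v u k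
  reverse here       = here
  reverse (step a r) = snoc (reverse r) (adj-sym H a)

  dist-unique : ∀ {u v k k'} → Dist H u v k → Dist H u v k' → k ≡ k'
  dist-unique (w , min) (w' , min') = ≤-antisym (min _ w') (min' _ w)

  dist-refl : ∀ {u} → Dist H u u 0
  dist-refl = here , λ _ _ → z≤n

  dist-sym : ∀ {u v k} → Dist H u v k → Dist H v u k
  dist-sym (w , min) = reverse w , λ l w' → min l (reverse w')

  dist-positive : ∀ {u v k} → Dist H u v k → ¬ u ≡ v → 1 ≤ k
  dist-positive {k = zero}  (w , _) u≢v = contradiction (walk-zero w) u≢v
  dist-positive {k = suc k} _       _   = s≤s z≤n

  between-sym : ∀ {a b c} → Between H a b c → Between H c b a
  between-sym (k , l , dab , dbc , dac) =
    l , k , dist-sym dbc , dist-sym dab , subst (Dist H _ _) (+-comm k l) (dist-sym dac)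

-- Fin (m * n) is read as m blocks of size n, the block of g ∈ Fin m consisting
-- of the elements combine g i.  A subset of Fin (m * n) is the concatenation of
-- its m rows (Data.Vec.group).
∣p++q∣ : ∀ {a b} (p : Subset a) (q : Subset b) → ∣ p ++ q ∣ ≡ ∣ p ∣ + ∣ q ∣
∣p++q∣ []            q = refl
∣p++q∣ (inside ∷ p)  q = cong suc (∣p++q∣ p q)
∣p++q∣ (outside ∷ p) q = ∣p++q∣ p q

∈-concat⁺ : ∀ {m n} (xss : Vec (Subset n) m) {g i} → i ∈ lookup xss g → combine g i ∈ concat xss
∈-concat⁺ xss {g} {i} i∈ =
  lookup⇒[]= (combine g i) (concat xss) (trans (lookup-concat xss g i) ([]=⇒lookup i∈))

∈-concat⁻ : ∀ {m n} (xss : Vec (Subset n) m) {g i} → combine g i ∈ concat xss → i ∈ lookup xss g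
∈-concat⁻ xss {g} {i} x∈ =
  lookup⇒[]= i (lookup xss g) (trans (sym (lookup-concat xss g i)) ([]=⇒lookup x∈))

blowUp : ∀ {m} n → Subset m → Subset (m * n)
blowUp n S = concat (map (replicate n) S)

∣blowUp∣ : ∀ {m} n (S : Subset m) → ∣ blowUp n S ∣ ≡ n * ∣ S ∣
∣blowUp∣ n []            = sym (*-zeroʳ n)
∣blowUp∣ n (inside ∷ S)  = begin
  ∣ ⊤ {n} ++ blowUp n S ∣    ≡⟨ ∣p++q∣ (⊤ {n}) (blowUp n S) ⟩
  ∣ ⊤ {n} ∣ + ∣ blowUp n S ∣ ≡⟨ cong₂ _+_ (∣⊤∣≡n n) (∣blowUp∣ n S) ⟩
  n + n * ∣ S ∣              ≡⟨ *-suc n ∣ S ∣ ⟨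
  n * suc ∣ S ∣              ∎
  where open ≡-Reasoning
∣blowUp∣ n (outside ∷ S) = trans (∣p++q∣ (⊥ {n}) (blowUp n S)) (cong₂ _+_ (∣⊥∣≡0 n) (∣blowUp∣ n S))

∈-blowUp : ∀ {m} n (S : Subset m) {x} → x ∈ blowUp n S → proj₁ (remQuot {m} n x) ∈ S
∈-blowUp {m} n S {x} x∈ = lookup⇒[]= g S (begin
  lookup S g                                ≡⟨ lookup-replicate i (lookup S g) ⟨
  lookup (replicate n (lookup S g)) i       ≡⟨ cong (λ p → lookup p i) (lookup-map g (replicate n) S) ⟨
  lookup (lookup (map (replicate n) S) g) i ≡⟨ []=⇒lookup (∈-concat⁻ (map (replicate n) S) x∈′) ⟩
  inside                                    ∎)
  where
  open ≡-Reasoning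
  g = proj₁ (remQuot {m} n x)
  i = proj₂ (remQuot {m} n x)
  x∈′ : combine g i ∈ blowUp n S
  x∈′ = subst (_∈ blowUp n S) (sym (combine-remQuot {m} n x)) x∈

occupied : ∀ {n} → Subset n → Bool
occupied p = does (nonempty? p)

occupied⇒nonempty : ∀ {n} (p : Subset n) → occupied p ≡ inside → Nonempty p
occupied⇒nonempty p eq with nonempty? p
... | yes ne = ne
... | no _   = contradiction eq λ ()

-- Each row has at most n elements, and none unless it is occupied.
∣concat∣≤ : ∀ {m n} (xss : Vec (Subset n) m) → ∣ concat xss ∣ ≤ n * ∣ map occupied xss ∣
∣concat∣≤ []         = z≤n
∣concat∣≤ {n = n} (p ∷ ps) with nonempty? p
... | yes _ = begin
  ∣ p ++ concat ps ∣          ≡⟨ ∣p++q∣ p (concat ps) ⟩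
  ∣ p ∣ + ∣ concat ps ∣       ≤⟨ +-mono-≤ (∣p∣≤n p) (∣concat∣≤ ps) ⟩
  n + n * ∣ map occupied ps ∣ ≡⟨ *-suc n _ ⟨
  n * suc ∣ map occupied ps ∣ ∎
  where open ≤-Reasoning
... | no empty = begin
  ∣ p ++ concat ps ∣          ≡⟨ ∣p++q∣ p (concat ps) ⟩
  ∣ p ∣ + ∣ concat ps ∣       ≡⟨ cong (λ q → ∣ q ∣ + ∣ concat ps ∣) (Empty-unique empty) ⟩
  ∣ ⊥ {n} ∣ + ∣ concat ps ∣   ≡⟨ cong (_+ ∣ concat ps ∣) (∣⊥∣≡0 n) ⟩
  ∣ concat ps ∣               ≤⟨ ∣concat∣≤ ps ⟩
  n * ∣ map occupied ps ∣     ∎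
  where open ≤-Reasoning

rows : ∀ {m} n → Subset (m * n) → Vec (Subset n) m
rows {m} n T = proj₁ (group m n T)

shadow : ∀ {m} n → Subset (m * n) → Subset m
shadow {m} n T = map occupied (rows {m} n T)

∣shadow∣ : ∀ {m} n (T : Subset (m * n)) → ∣ T ∣ ≤ n * ∣ shadow {m} n T ∣
∣shadow∣ {m} n T =
  subst (λ U → ∣ U ∣ ≤ n * ∣ shadow {m} n T ∣) (sym (proj₂ (group m n T))) (∣concat∣≤ (rows {m} n T))

∈-shadow : ∀ {m} n (T : Subset (m * n)) {g} → g ∈ shadow {m} n T → ∃[ i ] combine g i ∈ T
∈-shadow {m} n T {g} g∈ with occupied⇒nonempty (lookup (rows {m} n T) g)
                               (trans (sym (lookup-map g occupied (rows {m} n T))) ([]=⇒lookup g∈))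
... | i , i∈ = i , subst (combine g i ∈_) (sym (proj₂ (group m n T))) (∈-concat⁺ (rows {m} n T) i∈)

-- k is the largest size of a subset with property P (IsGP and IsCliqueNumber
-- are instances of this notion).
Maximum : ∀ {m} → (Subset m → Set) → ℕ → Set
Maximum P k = (∃[ S ] (P S × ∣ S ∣ ≡ k)) × (∀ S → P S → ∣ S ∣ ≤ k)

maximum-blowUp : ∀ {m} n {P : Subset m → Set} {Q : Subset (m * n) → Set} →
  (∀ S → P S → Q (blowUp n S)) → (∀ T → Q T → P (shadow {m} n T)) →
  ∀ {k} → Maximum P k → Maximum Q (n * k)
maximum-blowUp {m} n blow shade ((S , PS , ∣S∣≡k) , bound) =
  (blowUp n S , blow S PS , trans (∣blowUp∣ n S) (cong (n *_) ∣S∣≡k)) ,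
  λ T QT → ≤-trans (∣shadow∣ {m} n T) (*-monoʳ-≤ n (bound (shadow {m} n T) (shade T QT)))

module StrongProductWithClique (G : Graph) (n : ℕ) where

  Gₙ : Graph
  Gₙ = G ⊠ K n

  V : Set
  V = Fin (order G * n)

  π : V → Fin (order G)
  π x = proj₁ (remQuot {order G} n x)

  ι : V → Fin n
  ι x = proj₂ (remQuot {order G} n x)

  Close : Fin (order G) → Fin (order G) → Set
  Close a b = a ≡ b ⊎ Adj G a b

  π-combine : ∀ g i → π (combine g i) ≡ g
  π-combine g i = cong proj₁ (remQuot-combine {order G} {n} g i)

  ι-combine : ∀ g i → ι (combine g i) ≡ i
  ι-combine g i = cong proj₂ (remQuot-combine {order G} {n} g i)

  coordinates-determine : ∀ {x y} → π x ≡ π y → ι x ≡ ι y → x ≡ y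
  coordinates-determine {x} {y} p q = begin
    x                   ≡⟨ combine-remQuot {order G} n x ⟨
    combine (π x) (ι x) ≡⟨ cong₂ combine p q ⟩
    combine (π y) (ι y) ≡⟨ combine-remQuot {order G} n y ⟩
    y                   ∎
    where open ≡-Reasoning

  different-fibres : ∀ {x y} → ¬ π x ≡ π y → ¬ x ≡ y
  different-fibres ne refl = ne refl

  -- Since Kₙ is complete, adjacency in Gₙ only constrains the G-coordinates.
  adjacent-if-close : ∀ {x y} → ¬ x ≡ y → Close (π x) (π y) → Adj Gₙ x y
  adjacent-if-close {x} {y} x≢y c with ι x ≟ ι y
  ... | yes e = x≢y , c , inj₁ e
  ... | no e  = x≢y , c , inj₂ e

  adjacent-close : ∀ {x y} → Adj Gₙ x y → Close (π x) (π y)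
  adjacent-close a = proj₁ (proj₂ a)

  adjacent-to-fibre : ∀ {x w} → Adj G (π x) w → ∀ i → Adj Gₙ x (combine w i)
  adjacent-to-fibre {x} {w} a i =
    adjacent-if-close (different-fibres (λ e → irrefl G (subst (Adj G (π x)) (sym (trans e (π-combine w i))) a)))
                      (inj₂ (subst (Adj G (π x)) (sym (π-combine w i)) a))

  lift-in-layer : ∀ {a b k} → Walk G a b k → ∀ {x y} → π x ≡ a → π y ≡ b → ι x ≡ ι y → Walk Gₙ x y k
  lift-in-layer here {x} {y} refl πy q = subst (λ z → Walk Gₙ x z 0) (coordinates-determine (sym πy) q) here
  lift-in-layer (step {w = w} a r) {y = y} refl πy _ =
    step (adjacent-to-fibre a (ι y)) (lift-in-layer r (π-combine w (ι y)) πy (ι-combine w (ι y)))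

  lift-walk : ∀ {x y k} → Walk G (π x) (π y) (suc k) → Walk Gₙ x y (suc k)
  lift-walk {y = y} (step {w = w} a r) =
    step (adjacent-to-fibre a (ι y)) (lift-in-layer r (π-combine w (ι y)) refl (ι-combine w (ι y)))

  project-walk : ∀ {x y k} → Walk Gₙ x y k → ∃[ k' ] k' ≤ k × Walk G (π x) (π y) k'
  project-walk here = 0 , z≤n , here
  project-walk (step a r) with adjacent-close a | project-walk r
  ... | inj₁ e | k' , k'≤ , r' = k' , m≤n⇒m≤1+n k'≤ , subst (λ u → Walk G u _ k') (sym e) r'
  ... | inj₂ b | k' , k'≤ , r' = suc k' , s≤s k'≤ , step b r'

  dist-lift : ∀ {x y k} → ¬ π x ≡ π y → Dist G (π x) (π y) k → Dist Gₙ x y k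
  dist-lift {k = zero}  ne (w , _)   = contradiction (walk-zero w) ne
  dist-lift {k = suc k} ne (w , min) = lift-walk w , λ l w' →
    let (k' , k'≤l , w'') = project-walk w' in ≤-trans (min k' w'') k'≤l

  dist-project : ∀ {x y k} → ¬ π x ≡ π y → Dist Gₙ x y k → Dist G (π x) (π y) k
  dist-project {x} {y} {k} ne (w , min) with project-walk w
  ... | k' , k'≤k , w' = subst (Walk G (π x) (π y)) (≤-antisym k'≤k (min' k' w')) w' , min'
    where
    min' : ∀ l → Walk G (π x) (π y) l → k ≤ l
    min' zero    w₀ = contradiction (walk-zero w₀) ne
    min' (suc l) w₁ = min (suc l) (lift-walk w₁)

  dist-same-fibre : ∀ {x y} → π x ≡ π y → ¬ x ≡ y → Dist Gₙ x y 1
  dist-same-fibre {x} {y} e x≢y = step (adjacent-if-close x≢y (inj₁ e)) here , min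
    where
    min : ∀ l → Walk Gₙ x y l → 1 ≤ l
    min zero    w = contradiction (walk-zero w) x≢y
    min (suc l) _ = s≤s z≤n

  close-distance : ∀ {y w k} → Close (π y) (π w) → Dist Gₙ y w k → k ≤ 1
  close-distance {y} {w} c (_ , min) with y ≟ w
  ... | yes refl = m≤n⇒m≤1+n (min 0 here)
  ... | no y≢w   = min 1 (step (adjacent-if-close y≢w c) here)

  reroute-start : ∀ {x y z l} → π x ≡ π y → Walk Gₙ y z (suc l) → ∃[ l' ] l' ≤ suc l × Walk Gₙ x z l'
  reroute-start {x} {l = l} e (step {w = w} a r) with x ≟ w
  ... | yes refl = l , n≤1+n l , r
  ... | no x≢w   = suc l , ≤-refl , step (adjacent-if-close x≢w (subst (λ u → Close u (π w)) (sym e) (adjacent-close a))) r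

  twin-distance : ∀ {x y z k l} → π x ≡ π y → ¬ y ≡ z → Dist Gₙ y z l → Dist Gₙ x z k → k ≤ l
  twin-distance {l = zero}  _ y≢z (w , _) _         = contradiction (walk-zero w) y≢z
  twin-distance {l = suc l} e _   (w , _) (_ , min) with reroute-start e w
  ... | l' , l'≤ , w' = ≤-trans (min l' w') l'≤

  twin-end-not-between : ∀ {x y z} → π x ≡ π y → ¬ x ≡ y → ¬ y ≡ z → ¬ Between Gₙ x y z
  twin-end-not-between e x≢y y≢z (k , l , dxy , dyz , dxz) =
    positive-sum-too-long (dist-positive dxy x≢y) (twin-distance e y≢z dyz dxz)

  twin-ends-not-between : ∀ {x y z} → π x ≡ π z → ¬ x ≡ y → ¬ y ≡ z → ¬ Between Gₙ x y z
  twin-ends-not-between e x≢y y≢z (k , l , dxy , dyz , dxz) = positive-sum-too-long {1} {1} ≤-refl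
    (≤-trans (+-mono-≤ (dist-positive dxy x≢y) (dist-positive dyz y≢z)) (close-distance (inj₁ e) dxz))

  between-project : ∀ {x y z} → ¬ π x ≡ π y → ¬ π y ≡ π z → ¬ π x ≡ π z →
    Between Gₙ x y z → Between G (π x) (π y) (π z)
  between-project nxy nyz nxz (k , l , dxy , dyz , dxz) =
    k , l , dist-project nxy dxy , dist-project nyz dyz , dist-project nxz dxz

  between-lift : ∀ {x y z} → ¬ π x ≡ π y → ¬ π y ≡ π z → ¬ π x ≡ π z →
    Between G (π x) (π y) (π z) → Between Gₙ x y z
  between-lift nxy nyz nxz (k , l , dxy , dyz , dxz) =
    k , l , dist-lift nxy dxy , dist-lift nyz dyz , dist-lift nxz dxz

  representative : ∀ T {g} → g ∈ shadow {order G} n T → ∃[ x ] x ∈ T × π x ≡ g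
  representative T {g} g∈ with ∈-shadow n T g∈
  ... | i , i∈ = combine g i , i∈ , π-combine g i

  gp-blowUp : ∀ S → GPSet G S → GPSet Gₙ (blowUp n S)
  gp-blowUp S gpS x y z x∈ y∈ z∈ x≢y y≢z x≢z btw with π x ≟ π y | π y ≟ π z | π x ≟ π z
  ... | yes e  | _      | _      = twin-end-not-between e x≢y y≢z btw
  ... | no _   | yes e  | _      = twin-end-not-between (sym e) (≢-sym y≢z) (≢-sym x≢y) (between-sym btw)
  ... | no _   | no _   | yes e  = twin-ends-not-between e x≢y y≢z btw
  ... | no nxy | no nyz | no nxz =
    gpS (π x) (π y) (π z) (∈-blowUp n S x∈) (∈-blowUp n S y∈) (∈-blowUp n S z∈) nxy nyz nxz
        (between-project nxy nyz nxz btw)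

  gp-shadow : ∀ T → GPSet Gₙ T → GPSet G (shadow n T)
  gp-shadow T gpT a b c a∈ b∈ c∈ a≢b b≢c a≢c btw
    with representative T a∈ | representative T b∈ | representative T c∈
  ... | x , x∈ , refl | y , y∈ , refl | z , z∈ , refl =
    gpT x y z x∈ y∈ z∈ (different-fibres a≢b) (different-fibres b≢c) (different-fibres a≢c)
        (between-lift a≢b b≢c a≢c btw)

  -- Distinct twins are maximally distant from each other: they are at
  -- distance 1, and every neighbour of one is within distance 1 of the other.
  twins-maxDistant : ∀ {x y} → π x ≡ π y → ¬ x ≡ y → MaxDistant Gₙ x y
  twins-maxDistant {x} {y} e x≢y w a k l dyw dxy =
    subst (k ≤_) (dist-unique (dist-same-fibre e x≢y) dxy)
          (close-distance (subst (λ u → Close u (π w)) e (adjacent-close a)) dyw)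

  maxDistant-lift : ∀ {x y} → ¬ π x ≡ π y → MaxDistant G (π x) (π y) → MaxDistant Gₙ x y
  maxDistant-lift {x} {y} nxy md w a k l dyw dxy with adjacent-close a
  ... | inj₁ πx≡πw = twin-distance (sym πx≡πw) (different-fibres nxy) dxy (dist-sym dyw)
  ... | inj₂ adj with π y ≟ π w
  ...   | yes e  = ≤-trans (close-distance (inj₁ e) dyw) (dist-positive dxy (different-fibres nxy))
  ...   | no nyw = md (π w) adj k l (dist-project nyw dyw) (dist-project nxy dxy)

  maxDistant-project : ∀ {x y} → ¬ π x ≡ π y → MaxDistant Gₙ x y → MaxDistant G (π x) (π y)
  maxDistant-project {x} {y} nxy md w a k l dyw dxy with π y ≟ w
  ... | yes refl = subst (_≤ l) (dist-unique dist-refl dyw) z≤n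
  ... | no nyw   = md (combine w (ι x)) (adjacent-to-fibre a (ι x)) k l
                      (dist-lift nyw′ (subst (λ v → Dist G (π y) v k) (sym πw′) dyw)) (dist-lift nxy dxy)
    where
    πw′ : π (combine w (ι x)) ≡ w
    πw′ = π-combine w (ι x)
    nyw′ : ¬ π y ≡ π (combine w (ι x))
    nyw′ e = nyw (trans e πw′)

  clique-blowUp : ∀ C → Clique (SR G) C → Clique (SR Gₙ) (blowUp n C)
  clique-blowUp C clique x y x∈ y∈ x≢y = x≢y , maxDistant x∈ y∈ x≢y , maxDistant y∈ x∈ (≢-sym x≢y)
    where
    maxDistant : ∀ {u v} → u ∈ blowUp n C → v ∈ blowUp n C → ¬ u ≡ v → MaxDistant Gₙ u v
    maxDistant {u} {v} u∈ v∈ u≢v with π u ≟ π v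
    ... | yes e = twins-maxDistant e u≢v
    ... | no ne = maxDistant-lift ne (proj₁ (proj₂ (clique (π u) (π v) (∈-blowUp n C u∈) (∈-blowUp n C v∈) ne)))

  clique-shadow : ∀ T → Clique (SR Gₙ) T → Clique (SR G) (shadow n T)
  clique-shadow T clique a b a∈ b∈ a≢b with representative T a∈ | representative T b∈
  ... | x , x∈ , refl | y , y∈ , refl with clique x y x∈ y∈ (different-fibres a≢b)
  ... | _ , mxy , myx = a≢b , maxDistant-project a≢b mxy , maxDistant-project (≢-sym a≢b) myx

-- The theorem.
proposition4p3 : (G : Graph) → Connected G → (n : ℕ) → 1 ≤ n → (g : ℕ) → IsGP G g →
    IsGP (G ⊠ K n) (n * g) × (IsCliqueNumber (SR G) g → IsCliqueNumber (SR (G ⊠ K n)) (n * g))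
proposition4p3 G _ n _ g gp =
  maximum-blowUp n gp-blowUp gp-shadow gp , maximum-blowUp n clique-blowUp clique-shadow
  where open StrongProductWithClique G n
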